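{- Let $G$ and $H$ be two non-trivial graphs of order $n$ and $n'$, respectively. Then: (i) $\varpi(G\oplus H)\ge \max\{(\varpi(G)-1)\omega(H),\ \omega(G)(\varpi(H)-1)\}+1$. (ii) If there exists a twins-free clique of $G$ of cardinality $\varpi(G)$ containing no vertex of degree $n-1$ and there exists a twins-free clique of $H$ of cardinality $\varpi(H)$ containing no vertex of degree $n'-1$, then $\varpi(G\oplus H)\ge \max\{\varpi(G)\omega(H),\ \omega(G)\varpi(H)\}$. (iii) If there exists a twins-free clique of $G$ of cardinality $\varpi(G)$ containing no vertex of degree $n-1$, then $\varpi(G\oplus H)\ge \max\{\varpi(G)\omega(H),\ \omega(G)(\varpi(H)-1)+1\}$.
   Context: All graphs are finite and simple; non-trivial means at least two vertices. $\omega$ denotes the clique number. A twins-free clique is a clique $X$ such that $N_G[u]\ne N_G[v]$ for all distinct $u,v\in X$; $\varpi(G)$ is the maximum cardinality of a twins-free clique. The Cartesian sum $G\oplus H$ of $G=(V_1,E_1)$ and $H=(V_2,E_2)$ has vertex set $V_1\times V_2$, with $(a,b)(c,d)$ an edge iff $ac\in E_1$ or $bd\in E_2$. -}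

module Defs where

open import Data.Nat using (ℕ; _≤_; _∸_)
open import Data.Bool using (Bool; true; false; _∨_)
open import Data.Fin using (Fin; _≟_; remQuot)
open import Data.Fin.Subset using (Subset; _∈_; ∣_∣; _∪_; ⁅_⁆)
open import Data.Vec using (tabulate)
open import Data.Product using (Σ; _×_; _,_; proj₁; proj₂)
open import Relation.Binary.PropositionalEquality using (_≡_; _≢_; cong₂)

record Graph (n : ℕ) : Set where
  field
    adj     : Fin n → Fin n → Bool
    adj-sym : ∀ u v → adj u v ≡ adj v u
    adj-irr : ∀ u → adj u u ≡ false

open Graph public

module _ {n : ℕ} (G : Graph n) where

  Adj : Fin n → Fin n → Set
  Adj u v = adj G u v ≡ true

  N : Fin n → Subset n
  N u = tabulate (adj G u)

  N[_] : Fin n → Subset n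
  N[ u ] = N u ∪ ⁅ u ⁆

  degree : Fin n → ℕ
  degree u = ∣ N u ∣

  IsClique : Subset n → Set
  IsClique S = ∀ u v → u ∈ S → v ∈ S → u ≢ v → Adj u v

  IsTwinsFreeClique : Subset n → Set
  IsTwinsFreeClique S =
    IsClique S × (∀ u v → u ∈ S → v ∈ S → u ≢ v → N[ u ] ≢ N[ v ])

  IsMaxCard : (Subset n → Set) → ℕ → Set
  IsMaxCard P k = Σ (Subset n) (λ S → P S × ∣ S ∣ ≡ k) × (∀ S → P S → ∣ S ∣ ≤ k)

  IsCliqueNumber : ℕ → Set
  IsCliqueNumber = IsMaxCard IsClique

  IsTwinsFreeCliqueNumber : ℕ → Set
  IsTwinsFreeCliqueNumber = IsMaxCard IsTwinsFreeClique

  HasMaxTFCliqueWithoutUniversal : ℕ → Set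
  HasMaxTFCliqueWithoutUniversal k =
    Σ (Subset n) λ S → IsTwinsFreeClique S × ∣ S ∣ ≡ k ×
      (∀ u → u ∈ S → degree u ≢ n ∸ 1)

-- Cartesian sum G ⊕ H on Fin (n * n') ≅ Fin n × Fin n' (via remQuot):
-- (a,b)(c,d) is an edge iff ac ∈ E(G) or bd ∈ E(H).
fstV : ∀ {n} n' → Fin (n Data.Nat.* n') → Fin n
fstV {n} n' i = proj₁ (remQuot {n} n' i)

sndV : ∀ {n} n' → Fin (n Data.Nat.* n') → Fin n'
sndV {n} n' i = proj₂ (remQuot {n} n' i)

_⊕_ : ∀ {n n'} → Graph n → Graph n' → Graph (n Data.Nat.* n')
_⊕_ {n} {n'} G H = record
  { adj     = λ i j → adj G (fstV n' i) (fstV n' j) ∨ adj H (sndV {n} n' i) (sndV {n} n' j)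
  ; adj-sym = λ i j → cong₂ _∨_ (adj-sym G (fstV n' i) (fstV n' j)) (adj-sym H (sndV {n} n' i) (sndV {n} n' j))
  ; adj-irr = λ i → cong₂ _∨_ (adj-irr G (fstV n' i)) (adj-irr H (sndV {n} n' i))
  }

-- Let X be a twins-free clique of G and K a clique of H. The rectangle X × K is a clique of
-- G ⊕ H, and two of its vertices (a, b), (a', b') can be twins only if a = a' and a is universal
-- in G: a vertex w ∈ N_G[a] ∖ N_G[a'] (which exists when a ≠ a', X being twins-free), or a
-- non-neighbour w ≠ a of a = a', yields the vertex (w, b') adjacent to exactly one of them.
-- Hence X × K is twins-free when X has no universal vertex, which gives ϖ(G)ω(H). In general X
-- contains at most one universal vertex u, and shrinking the row {u} × K to a single vertex
-- leaves a twins-free clique of size (ϖ(G) − 1)ω(H) + 1. Exchanging G and H gives the rest.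

module Submission where

open import Defs
open import Data.Nat using (ℕ; suc; _≤_; _∸_; _*_; _+_; _⊔_; s≤s)
open import Data.Nat.Properties using (+-suc; ⊔-lub; +-distribʳ-⊔)
open import Data.Bool using (Bool; true; false; _∨_; _∧_; if_then_else_)
open import Data.Bool.Properties using (∨-zeroʳ) renaming (_≟_ to _≟ᵇ_)
open import Data.Fin using (Fin; zero; suc; combine; _≟_)
open import Data.Fin.Properties using (remQuot-combine; combine-remQuot; any?; all?)
open import Data.Fin.Subset using (Subset; _∈_; _∉_; _⊆_; ∣_∣; _∪_; _-_; ⁅_⁆; ⊥; ⊤; ∁; Nonempty)
open import Data.Fin.Subset.Properties
  using (_∈?_; x∈⁅x⁆; x∈⁅y⁆⇒x≡y; x≢y⇒x∉⁅y⁆; x∉⁅y⁆⇒x≢y; ∣⁅x⁆∣≡1; ∣⊥∣≡0; ∣∁p∣≡n∸∣p∣;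
         x∈p∪q⁺; x∈p∪q⁻; x∉p⇒x∈∁p; x∈∁p⇒x∉p; ⊆-antisym; ⊆⊤; p─⊥≡p; p─q⊆p;
         nonempty?; Empty-unique)
open import Data.Vec using ([]; _∷_; here; there; _++_; lookup; map; concat)
open import Data.Vec.Properties using (lookup∘tabulate; lookup-map; lookup-concat; lookup-replicate; []=⇒lookup; lookup⇒[]=)
open import Data.Product using (_×_; _,_; proj₁; proj₂; ∃-syntax)
open import Data.Sum using (_⊎_; inj₁; inj₂; [_,_]) renaming (map to map-⊎)
open import Function using (_∘_)
open import Relation.Binary.PropositionalEquality using (_≡_; _≢_; refl; sym; trans; cong; cong₂; subst; module ≡-Reasoning)
open import Relation.Nullary using (¬_; Dec; yes; no; contradiction)
open import Relation.Nullary.Decidable using (_→-dec_; _×-dec_; ¬?)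

∨≡true⁻ : ∀ x {y} → x ∨ y ≡ true → x ≡ true ⊎ y ≡ true
∨≡true⁻ true  _ = inj₁ refl
∨≡true⁻ false p = inj₂ p

∧≡true⁻ : ∀ x {y} → x ∧ y ≡ true → x ≡ true × y ≡ true
∧≡true⁻ true p = refl , p

∧≡true⁺ : ∀ {x y} → x ≡ true → y ≡ true → x ∧ y ≡ true
∧≡true⁺ refl refl = refl

private
  variable
    m n : ℕ

∣p++q∣≡∣p∣+∣q∣ : (p : Subset m) (q : Subset n) → ∣ p ++ q ∣ ≡ ∣ p ∣ + ∣ q ∣
∣p++q∣≡∣p∣+∣q∣ []          q = refl
∣p++q∣≡∣p∣+∣q∣ (true  ∷ p) q = cong suc (∣p++q∣≡∣p∣+∣q∣ p q)
∣p++q∣≡∣p∣+∣q∣ (false ∷ p) q = ∣p++q∣≡∣p∣+∣q∣ p q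

∣p∪q∣≡∣p∣+∣q∣ : (p q : Subset n) → (∀ {x} → x ∈ p → x ∉ q) → ∣ p ∪ q ∣ ≡ ∣ p ∣ + ∣ q ∣
∣p∪q∣≡∣p∣+∣q∣ []          []          _ = refl
∣p∪q∣≡∣p∣+∣q∣ (true  ∷ p) (true  ∷ q) d = contradiction here (d here)
∣p∪q∣≡∣p∣+∣q∣ (true  ∷ p) (false ∷ q) d = cong suc (∣p∪q∣≡∣p∣+∣q∣ p q (λ x∈p → d (there x∈p) ∘ there))
∣p∪q∣≡∣p∣+∣q∣ (false ∷ p) (true  ∷ q) d =
  trans (cong suc (∣p∪q∣≡∣p∣+∣q∣ p q (λ x∈p → d (there x∈p) ∘ there))) (sym (+-suc ∣ p ∣ ∣ q ∣))
∣p∪q∣≡∣p∣+∣q∣ (false ∷ p) (false ∷ q) d = ∣p∪q∣≡∣p∣+∣q∣ p q (λ x∈p → d (there x∈p) ∘ there)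

suc∣p-x∣≡∣p∣ : ∀ {x} {p : Subset n} → x ∈ p → suc ∣ p - x ∣ ≡ ∣ p ∣
suc∣p-x∣≡∣p∣ {p = true  ∷ p} here        = cong (suc ∘ ∣_∣) (p─⊥≡p p)
suc∣p-x∣≡∣p∣ {p = true  ∷ p} (there x∈p) = cong suc (suc∣p-x∣≡∣p∣ x∈p)
suc∣p-x∣≡∣p∣ {p = false ∷ p} (there x∈p) = suc∣p-x∣≡∣p∣ x∈p

x∉p-x : ∀ {x} (p : Subset n) → x ∉ p - x
x∉p-x {x = zero}  (_ ∷ p) ()
x∉p-x {x = suc x} (_ ∷ p) (there x∈p-x) = x∉p-x p x∈p-x

x∈p-y⇒x≢y : ∀ {x y} {p : Subset n} → x ∈ p - y → x ≢ y
x∈p-y⇒x≢y {p = p} x∈p-y refl = x∉p-x p x∈p-y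

⁅x⁆⊆p : ∀ {x : Fin n} {p} → x ∈ p → ⁅ x ⁆ ⊆ p
⁅x⁆⊆p {x = x} {p} x∈p y∈⁅x⁆ = subst (_∈ p) (sym (x∈⁅y⁆⇒x≡y x y∈⁅x⁆)) x∈p

1≤∣p∣⇒nonempty : (p : Subset n) → 1 ≤ ∣ p ∣ → Nonempty p
1≤∣p∣⇒nonempty {n} p 1≤∣p∣ with nonempty? p
... | yes ne = ne
... | no ¬ne = contradiction (subst (1 ≤_) (trans (cong ∣_∣ (Empty-unique ¬ne)) (∣⊥∣≡0 n)) 1≤∣p∣) λ ()

module _ (G : Graph n) where

  Adj-sym : ∀ {u v} → Adj G u v → Adj G v u
  Adj-sym {u} {v} uv = trans (adj-sym G v u) uv

  Adj-irrefl : ∀ {u} → ¬ Adj G u u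
  Adj-irrefl {u} uu = contradiction (trans (sym uu) (adj-irr G u)) λ ()

  ∈N⁺ : ∀ {u w} → Adj G u w → w ∈ N G u
  ∈N⁺ {u} {w} uw = lookup⇒[]= w (N G u) (trans (lookup∘tabulate (adj G u) w) uw)

  ∈N⁻ : ∀ {u w} → w ∈ N G u → Adj G u w
  ∈N⁻ {u} {w} w∈N = trans (sym (lookup∘tabulate (adj G u) w)) ([]=⇒lookup w∈N)

  ∈N[]⁺ : ∀ {u w} → Adj G u w ⊎ w ≡ u → w ∈ N[_] G u
  ∈N[]⁺ (inj₁ uw)   = x∈p∪q⁺ (inj₁ (∈N⁺ uw))
  ∈N[]⁺ (inj₂ refl) = x∈p∪q⁺ (inj₂ (x∈⁅x⁆ _))

  ∈N[]⁻ : ∀ {u w} → w ∈ N[_] G u → Adj G u w ⊎ w ≡ u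
  ∈N[]⁻ {u} w∈N[u] = [ inj₁ ∘ ∈N⁻ , inj₂ ∘ x∈⁅y⁆⇒x≡y u ] (x∈p∪q⁻ (N G u) ⁅ u ⁆ w∈N[u])

  Twins : Fin n → Fin n → Set
  Twins u v = N[_] G u ≡ N[_] G v

  Universal : Fin n → Set
  Universal u = ∀ w → w ≢ u → Adj G u w

  universal? : ∀ u → Dec (Universal u)
  universal? u = all? λ w → ¬? (w ≟ u) →-dec (adj G u w ≟ᵇ true)

  universal⇒N[]≡⊤ : ∀ {u} → Universal u → N[_] G u ≡ ⊤
  universal⇒N[]≡⊤ {u} univ = ⊆-antisym ⊆⊤ λ {w} _ → ∈N[]⁺ (adjacent-or-equal (w ≟ u))
    where
    adjacent-or-equal : ∀ {w} → Dec (w ≡ u) → Adj G u w ⊎ w ≡ u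
    adjacent-or-equal {w} (yes w≡u) = inj₂ w≡u
    adjacent-or-equal {w} (no  w≢u) = inj₁ (univ w w≢u)

  universal⇒degree≡n∸1 : ∀ {u} → Universal u → degree G u ≡ n ∸ 1
  universal⇒degree≡n∸1 {u} univ = begin
    ∣ N G u ∣       ≡⟨ cong ∣_∣ (⊆-antisym N⊆∁⁅u⁆ ∁⁅u⁆⊆N) ⟩
    ∣ ∁ ⁅ u ⁆ ∣     ≡⟨ ∣∁p∣≡n∸∣p∣ ⁅ u ⁆ ⟩
    n ∸ ∣ ⁅ u ⁆ ∣   ≡⟨ cong (n ∸_) (∣⁅x⁆∣≡1 u) ⟩
    n ∸ 1           ∎
    where
    open ≡-Reasoning
    N⊆∁⁅u⁆ : N G u ⊆ ∁ ⁅ u ⁆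
    N⊆∁⁅u⁆ w∈N = x∉p⇒x∈∁p (x≢y⇒x∉⁅y⁆ λ { refl → Adj-irrefl (∈N⁻ w∈N) })
    ∁⁅u⁆⊆N : ∁ ⁅ u ⁆ ⊆ N G u
    ∁⁅u⁆⊆N {w} w∈∁ = ∈N⁺ (univ w (x∉⁅y⁆⇒x≢y (x∈∁p⇒x∉p w∈∁)))

  ⁅x⁆-isTwinsFreeClique : ∀ x → IsTwinsFreeClique G ⁅ x ⁆
  ⁅x⁆-isTwinsFreeClique x = (λ u v u∈ v∈ u≢v → contradiction (same u∈ v∈) u≢v)
                         , (λ u v u∈ v∈ u≢v → contradiction (same u∈ v∈) u≢v)
    where
    same : ∀ {u v} → u ∈ ⁅ x ⁆ → v ∈ ⁅ x ⁆ → u ≡ v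
    same u∈ v∈ = trans (x∈⁅y⁆⇒x≡y x u∈) (sym (x∈⁅y⁆⇒x≡y x v∈))

  1≤ω : Fin n → ∀ {k} → IsCliqueNumber G k → 1 ≤ k
  1≤ω x (_ , maximal) = subst (_≤ _) (∣⁅x⁆∣≡1 x) (maximal ⁅ x ⁆ (proj₁ (⁅x⁆-isTwinsFreeClique x)))

  1≤ϖ : Fin n → ∀ {k} → IsTwinsFreeCliqueNumber G k → 1 ≤ k
  1≤ϖ x (_ , maximal) = subst (_≤ _) (∣⁅x⁆∣≡1 x) (maximal ⁅ x ⁆ (⁅x⁆-isTwinsFreeClique x))

  -- At most one vertex of a twins-free clique is universal, since universal vertices are twins.
  universal-candidate : ∀ {X} → IsTwinsFreeClique G X → Nonempty X →
    ∃[ u ] u ∈ X × (∀ {a} → a ∈ X → Universal a → a ≡ u)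
  universal-candidate {X} (_ , twinsFree) (x , x∈X)
    with any? (λ u → (u ∈? X) ×-dec universal? u)
  ... | yes (u , u∈X , univ-u) = u , u∈X , unique
    where
    unique : ∀ {a} → a ∈ X → Universal a → a ≡ u
    unique {a} a∈X univ-a with a ≟ u
    ... | yes a≡u = a≡u
    ... | no  a≢u = contradiction (trans (universal⇒N[]≡⊤ univ-a) (sym (universal⇒N[]≡⊤ univ-u)))
                                  (twinsFree a u a∈X u∈X a≢u)
  ... | no ∄ = x , x∈X , λ {a} a∈X univ-a → contradiction (a , a∈X , univ-a) ∄


module _ {n n' : ℕ} where

  π₁ : Fin (n * n') → Fin n
  π₁ = fstV n'

  π₂ : Fin (n * n') → Fin n'
  π₂ = sndV {n} n'

  π₁-combine : ∀ a b → π₁ (combine a b) ≡ a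
  π₁-combine a b = cong proj₁ (remQuot-combine {n} {n'} a b)

  π₂-combine : ∀ a b → π₂ (combine a b) ≡ b
  π₂-combine a b = cong proj₂ (remQuot-combine {n} {n'} a b)

  π-injective : ∀ {i j} → π₁ i ≡ π₁ j → π₂ i ≡ π₂ j → i ≡ j
  π-injective {i} {j} e₁ e₂ =
    trans (sym (combine-remQuot {n} n' i)) (trans (cong₂ combine e₁ e₂) (combine-remQuot {n} n' j))

  -- Row a of A ⊠ B is B if a ∈ A and empty otherwise; rows are concatenated as in Fin.combine.
  _⊠_ : Subset n → Subset n' → Subset (n * n')
  A ⊠ B = concat (map (λ a → if a then B else ⊥) A)

  ∣A⊠B∣≡∣A∣*∣B∣ : ∀ (A : Subset n) (B : Subset n') → ∣ A ⊠ B ∣ ≡ ∣ A ∣ * ∣ B ∣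
  ∣A⊠B∣≡∣A∣*∣B∣ = go
    where
    go : ∀ {m} (A : Subset m) B → ∣ concat (map (λ a → if a then B else ⊥) A) ∣ ≡ ∣ A ∣ * ∣ B ∣
    go []          B = refl
    go (true  ∷ A) B = trans (∣p++q∣≡∣p∣+∣q∣ B _) (cong (∣ B ∣ +_) (go A B))
    go (false ∷ A) B = trans (∣p++q∣≡∣p∣+∣q∣ (⊥ {n'}) _) (cong₂ _+_ (∣⊥∣≡0 n') (go A B))

  lookup-⊠ : ∀ A B i → lookup (A ⊠ B) i ≡ lookup A (π₁ i) ∧ lookup B (π₂ i)
  lookup-⊠ A B i = begin
    lookup (A ⊠ B) i                           ≡⟨ cong (lookup (A ⊠ B)) (sym (combine-remQuot {n} n' i)) ⟩
    lookup (A ⊠ B) (combine (π₁ i) (π₂ i))     ≡⟨ lookup-concat (map row A) (π₁ i) (π₂ i) ⟩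
    lookup (lookup (map row A) (π₁ i)) (π₂ i)  ≡⟨ cong (λ r → lookup r (π₂ i)) (lookup-map (π₁ i) row A) ⟩
    lookup (row (lookup A (π₁ i))) (π₂ i)      ≡⟨ lookup-row (lookup A (π₁ i)) ⟩
    lookup A (π₁ i) ∧ lookup B (π₂ i)          ∎
    where
    open ≡-Reasoning
    row : Bool → Subset n'
    row a = if a then B else ⊥
    lookup-row : ∀ a → lookup (row a) (π₂ i) ≡ a ∧ lookup B (π₂ i)
    lookup-row true  = refl
    lookup-row false = lookup-replicate (π₂ i) false

  ∈⊠⁺ : ∀ {A B i} → π₁ i ∈ A → π₂ i ∈ B → i ∈ A ⊠ B
  ∈⊠⁺ {A} {B} {i} a∈A b∈B =
    lookup⇒[]= i (A ⊠ B) (trans (lookup-⊠ A B i) (∧≡true⁺ ([]=⇒lookup a∈A) ([]=⇒lookup b∈B)))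

  ∈⊠⁻ : ∀ {A B i} → i ∈ A ⊠ B → π₁ i ∈ A × π₂ i ∈ B
  ∈⊠⁻ {A} {B} {i} i∈A⊠B with ∧≡true⁻ (lookup A (π₁ i)) (trans (sym (lookup-⊠ A B i)) ([]=⇒lookup i∈A⊠B))
  ... | a∈A , b∈B = lookup⇒[]= (π₁ i) A a∈A , lookup⇒[]= (π₂ i) B b∈B

  ⊠-mono : ∀ {A A' B B'} → A ⊆ A' → B ⊆ B' → A ⊠ B ⊆ A' ⊠ B'
  ⊠-mono {A} {A'} {B} {B'} A⊆A' B⊆B' i∈A⊠B with ∈⊠⁻ {A} {B} i∈A⊠B
  ... | a∈A , b∈B = ∈⊠⁺ (A⊆A' a∈A) (B⊆B' b∈B)

  ∣[A-a]⊠B∪⁅a⁆⊠⁅b⁆∣ : ∀ {A a} B b → a ∈ A → ∣ (A - a) ⊠ B ∪ ⁅ a ⁆ ⊠ ⁅ b ⁆ ∣ ≡ (∣ A ∣ ∸ 1) * ∣ B ∣ + 1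
  ∣[A-a]⊠B∪⁅a⁆⊠⁅b⁆∣ {A} {a} B b a∈A = begin
    ∣ (A - a) ⊠ B ∪ ⁅ a ⁆ ⊠ ⁅ b ⁆ ∣           ≡⟨ ∣p∪q∣≡∣p∣+∣q∣ ((A - a) ⊠ B) (⁅ a ⁆ ⊠ ⁅ b ⁆) disjoint ⟩
    ∣ (A - a) ⊠ B ∣ + ∣ ⁅ a ⁆ ⊠ ⁅ b ⁆ ∣       ≡⟨ cong₂ _+_ (∣A⊠B∣≡∣A∣*∣B∣ (A - a) B) (∣A⊠B∣≡∣A∣*∣B∣ ⁅ a ⁆ ⁅ b ⁆) ⟩
    ∣ A - a ∣ * ∣ B ∣ + ∣ ⁅ a ⁆ ∣ * ∣ ⁅ b ⁆ ∣
      ≡⟨ cong₂ (λ s t → s * ∣ B ∣ + t) (cong (_∸ 1) (suc∣p-x∣≡∣p∣ a∈A)) (cong₂ _*_ (∣⁅x⁆∣≡1 a) (∣⁅x⁆∣≡1 b)) ⟩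
    (∣ A ∣ ∸ 1) * ∣ B ∣ + 1                   ∎
    where
    open ≡-Reasoning
    disjoint : ∀ {i} → i ∈ (A - a) ⊠ B → i ∉ ⁅ a ⁆ ⊠ ⁅ b ⁆
    disjoint i∈ i∈⁅a⁆⊠⁅b⁆ =
      x∈p-y⇒x≢y (proj₁ (∈⊠⁻ {A - a} {B} i∈)) (x∈⁅y⁆⇒x≡y a (proj₁ (∈⊠⁻ {⁅ a ⁆} {⁅ b ⁆} i∈⁅a⁆⊠⁅b⁆)))

  ∣A⊠[B-b]∪⁅a⁆⊠⁅b⁆∣ : ∀ {B b} A a → b ∈ B → ∣ A ⊠ (B - b) ∪ ⁅ a ⁆ ⊠ ⁅ b ⁆ ∣ ≡ ∣ A ∣ * (∣ B ∣ ∸ 1) + 1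
  ∣A⊠[B-b]∪⁅a⁆⊠⁅b⁆∣ {B} {b} A a b∈B = begin
    ∣ A ⊠ (B - b) ∪ ⁅ a ⁆ ⊠ ⁅ b ⁆ ∣           ≡⟨ ∣p∪q∣≡∣p∣+∣q∣ (A ⊠ (B - b)) (⁅ a ⁆ ⊠ ⁅ b ⁆) disjoint ⟩
    ∣ A ⊠ (B - b) ∣ + ∣ ⁅ a ⁆ ⊠ ⁅ b ⁆ ∣       ≡⟨ cong₂ _+_ (∣A⊠B∣≡∣A∣*∣B∣ A (B - b)) (∣A⊠B∣≡∣A∣*∣B∣ ⁅ a ⁆ ⁅ b ⁆) ⟩
    ∣ A ∣ * ∣ B - b ∣ + ∣ ⁅ a ⁆ ∣ * ∣ ⁅ b ⁆ ∣
      ≡⟨ cong₂ (λ s t → ∣ A ∣ * s + t) (cong (_∸ 1) (suc∣p-x∣≡∣p∣ b∈B)) (cong₂ _*_ (∣⁅x⁆∣≡1 a) (∣⁅x⁆∣≡1 b)) ⟩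
    ∣ A ∣ * (∣ B ∣ ∸ 1) + 1                   ∎
    where
    open ≡-Reasoning
    disjoint : ∀ {i} → i ∈ A ⊠ (B - b) → i ∉ ⁅ a ⁆ ⊠ ⁅ b ⁆
    disjoint i∈ i∈⁅a⁆⊠⁅b⁆ =
      x∈p-y⇒x≢y (proj₂ (∈⊠⁻ {A} {B - b} i∈)) (x∈⁅y⁆⇒x≡y b (proj₂ (∈⊠⁻ {⁅ a ⁆} {⁅ b ⁆} i∈⁅a⁆⊠⁅b⁆)))

  module _ (G : Graph n) (H : Graph n') where

    Adj-⊕⁻ : ∀ {i j} → Adj (G ⊕ H) i j → Adj G (π₁ i) (π₁ j) ⊎ Adj H (π₂ i) (π₂ j)
    Adj-⊕⁻ {i} {j} = ∨≡true⁻ (adj G (π₁ i) (π₁ j))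

    Adj-⊕⁺ : ∀ {i j} → Adj G (π₁ i) (π₁ j) ⊎ Adj H (π₂ i) (π₂ j) → Adj (G ⊕ H) i j
    Adj-⊕⁺         (inj₁ g) = cong (_∨ _) g
    Adj-⊕⁺ {i} {j} (inj₂ h) = trans (cong (adj G (π₁ i) (π₁ j) ∨_) h) (∨-zeroʳ _)

    combine∈N[]-⊕ : ∀ {i a b} → Adj G (π₁ i) a ⊎ Adj H (π₂ i) b → combine a b ∈ N[_] (G ⊕ H) i
    combine∈N[]-⊕ {i} {a} {b} adjacent = ∈N[]⁺ (G ⊕ H) (inj₁ (Adj-⊕⁺ (map-⊎
      (subst (Adj G (π₁ i)) (sym (π₁-combine a b)))
      (subst (Adj H (π₂ i)) (sym (π₂-combine a b)))
      adjacent)))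

    ∈N[]-⊕⇒∈N[]ˡ : ∀ {j a} → combine a (π₂ j) ∈ N[_] (G ⊕ H) j → a ∈ N[_] G (π₁ j)
    ∈N[]-⊕⇒∈N[]ˡ {j} {a} v∈N[j] with ∈N[]⁻ (G ⊕ H) v∈N[j]
    ... | inj₂ v≡j = ∈N[]⁺ G (inj₂ (trans (sym (π₁-combine a (π₂ j))) (cong π₁ v≡j)))
    ... | inj₁ jv with Adj-⊕⁻ jv
    ...   | inj₁ g = ∈N[]⁺ G (inj₁ (subst (Adj G (π₁ j)) (π₁-combine a (π₂ j)) g))
    ...   | inj₂ h = contradiction (subst (Adj H (π₂ j)) (π₂-combine a (π₂ j)) h) (Adj-irrefl H)

    ∈N[]-⊕⇒∈N[]ʳ : ∀ {j b} → combine (π₁ j) b ∈ N[_] (G ⊕ H) j → b ∈ N[_] H (π₂ j)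
    ∈N[]-⊕⇒∈N[]ʳ {j} {b} v∈N[j] with ∈N[]⁻ (G ⊕ H) v∈N[j]
    ... | inj₂ v≡j = ∈N[]⁺ H (inj₂ (trans (sym (π₂-combine (π₁ j) b)) (cong π₂ v≡j)))
    ... | inj₁ jv with Adj-⊕⁻ jv
    ...   | inj₁ g = contradiction (subst (Adj G (π₁ j)) (π₁-combine (π₁ j) b) g) (Adj-irrefl G)
    ...   | inj₂ h = ∈N[]⁺ H (inj₁ (subst (Adj H (π₂ j)) (π₂-combine (π₁ j) b) h))

    twin-∈N[]ˡ : ∀ {i j a} → Twins (G ⊕ H) i j → Adj G (π₁ i) a ⊎ Adj H (π₂ i) (π₂ j) → a ∈ N[_] G (π₁ j)
    twin-∈N[]ˡ {i} {j} {a} i≈j adjacent = ∈N[]-⊕⇒∈N[]ˡ (subst (combine a (π₂ j) ∈_) i≈j (combine∈N[]-⊕ adjacent))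

    twin-∈N[]ʳ : ∀ {i j b} → Twins (G ⊕ H) i j → Adj G (π₁ i) (π₁ j) ⊎ Adj H (π₂ i) b → b ∈ N[_] H (π₂ j)
    twin-∈N[]ʳ {i} {j} {b} i≈j adjacent = ∈N[]-⊕⇒∈N[]ʳ (subst (combine (π₁ j) b ∈_) i≈j (combine∈N[]-⊕ adjacent))

    twins⇒N[]⊆ˡ : ∀ {i j} → Adj (G ⊕ H) i j → Twins (G ⊕ H) i j → N[_] G (π₁ i) ⊆ N[_] G (π₁ j)
    twins⇒N[]⊆ˡ ij i≈j a∈N[i] with ∈N[]⁻ G a∈N[i] | Adj-⊕⁻ ij
    ... | inj₁ ia   | _      = twin-∈N[]ˡ i≈j (inj₁ ia)
    ... | inj₂ refl | inj₁ g = ∈N[]⁺ G (inj₁ (Adj-sym G g))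
    ... | inj₂ refl | inj₂ h = twin-∈N[]ˡ i≈j (inj₂ h)

    twins⇒N[]⊆ʳ : ∀ {i j} → Adj (G ⊕ H) i j → Twins (G ⊕ H) i j → N[_] H (π₂ i) ⊆ N[_] H (π₂ j)
    twins⇒N[]⊆ʳ ij i≈j b∈N[i] with ∈N[]⁻ H b∈N[i] | Adj-⊕⁻ ij
    ... | inj₁ ib   | _      = twin-∈N[]ʳ i≈j (inj₂ ib)
    ... | inj₂ refl | inj₁ g = twin-∈N[]ʳ i≈j (inj₁ g)
    ... | inj₂ refl | inj₂ h = ∈N[]⁺ H (inj₁ (Adj-sym H h))

    twins⇒twinsˡ : ∀ {i j} → Adj (G ⊕ H) i j → Twins (G ⊕ H) i j → Twins G (π₁ i) (π₁ j)
    twins⇒twinsˡ ij i≈j = ⊆-antisym (twins⇒N[]⊆ˡ ij i≈j) (twins⇒N[]⊆ˡ (Adj-sym (G ⊕ H) ij) (sym i≈j))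

    twins⇒twinsʳ : ∀ {i j} → Adj (G ⊕ H) i j → Twins (G ⊕ H) i j → Twins H (π₂ i) (π₂ j)
    twins⇒twinsʳ ij i≈j = ⊆-antisym (twins⇒N[]⊆ʳ ij i≈j) (twins⇒N[]⊆ʳ (Adj-sym (G ⊕ H) ij) (sym i≈j))

    twins⇒universalˡ : ∀ {i j} → Adj (G ⊕ H) i j → Twins (G ⊕ H) i j → π₁ i ≡ π₁ j → Universal G (π₁ i)
    twins⇒universalˡ {i} ij i≈j e a a≢π₁i with Adj-⊕⁻ ij
    ... | inj₁ g = contradiction (subst (Adj G (π₁ i)) (sym e) g) (Adj-irrefl G)
    ... | inj₂ h with ∈N[]⁻ G (twin-∈N[]ˡ i≈j (inj₂ h))
    ...   | inj₁ ja = subst (λ c → Adj G c a) (sym e) ja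
    ...   | inj₂ a≡ = contradiction (trans a≡ (sym e)) a≢π₁i

    twins⇒universalʳ : ∀ {i j} → Adj (G ⊕ H) i j → Twins (G ⊕ H) i j → π₂ i ≡ π₂ j → Universal H (π₂ i)
    twins⇒universalʳ {i} ij i≈j e b b≢π₂i with Adj-⊕⁻ ij
    ... | inj₂ h = contradiction (subst (Adj H (π₂ i)) (sym e) h) (Adj-irrefl H)
    ... | inj₁ g with ∈N[]⁻ H (twin-∈N[]ʳ i≈j (inj₁ g))
    ...   | inj₁ jb = subst (λ c → Adj H c b) (sym e) jb
    ...   | inj₂ b≡ = contradiction (trans b≡ (sym e)) b≢π₂i

    ⊠-isClique : ∀ {X Y} → IsClique G X → IsClique H Y → IsClique (G ⊕ H) (X ⊠ Y)
    ⊠-isClique {X} {Y} cX cY i j i∈ j∈ i≢j with ∈⊠⁻ {X} {Y} i∈ | ∈⊠⁻ {X} {Y} j∈ | π₁ i ≟ π₁ j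
    ... | xi , _  | xj , _  | no  π₁i≢π₁j = Adj-⊕⁺ (inj₁ (cX _ _ xi xj π₁i≢π₁j))
    ... | _  , yi | _  , yj | yes π₁i≡π₁j = Adj-⊕⁺ (inj₂ (cY _ _ yi yj (i≢j ∘ π-injective π₁i≡π₁j)))

    twinsFreeˡ : ∀ {X Y S} → IsTwinsFreeClique G X → IsClique H Y → S ⊆ X ⊠ Y →
      (∀ {i j} → i ∈ S → j ∈ S → π₁ i ≡ π₁ j → Universal G (π₁ i) → i ≡ j) →
      IsTwinsFreeClique (G ⊕ H) S
    twinsFreeˡ {X} {Y} {S} (cX , tfX) cY S⊆X⊠Y collapse = clique , twinsFree
      where
      clique : IsClique (G ⊕ H) S
      clique i j i∈S j∈S = ⊠-isClique cX cY i j (S⊆X⊠Y i∈S) (S⊆X⊠Y j∈S)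
      twinsFree : ∀ i j → i ∈ S → j ∈ S → i ≢ j → ¬ Twins (G ⊕ H) i j
      twinsFree i j i∈S j∈S i≢j i≈j with π₁ i ≟ π₁ j
      ... | yes π₁i≡π₁j =
        i≢j (collapse i∈S j∈S π₁i≡π₁j (twins⇒universalˡ (clique i j i∈S j∈S i≢j) i≈j π₁i≡π₁j))
      ... | no  π₁i≢π₁j =
        tfX _ _ (proj₁ (∈⊠⁻ {X} {Y} (S⊆X⊠Y i∈S))) (proj₁ (∈⊠⁻ {X} {Y} (S⊆X⊠Y j∈S))) π₁i≢π₁j
                (twins⇒twinsˡ (clique i j i∈S j∈S i≢j) i≈j)

    twinsFreeʳ : ∀ {X Y S} → IsClique G X → IsTwinsFreeClique H Y → S ⊆ X ⊠ Y →
      (∀ {i j} → i ∈ S → j ∈ S → π₂ i ≡ π₂ j → Universal H (π₂ i) → i ≡ j) →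
      IsTwinsFreeClique (G ⊕ H) S
    twinsFreeʳ {X} {Y} {S} cX (cY , tfY) S⊆X⊠Y collapse = clique , twinsFree
      where
      clique : IsClique (G ⊕ H) S
      clique i j i∈S j∈S = ⊠-isClique cX cY i j (S⊆X⊠Y i∈S) (S⊆X⊠Y j∈S)
      twinsFree : ∀ i j → i ∈ S → j ∈ S → i ≢ j → ¬ Twins (G ⊕ H) i j
      twinsFree i j i∈S j∈S i≢j i≈j with π₂ i ≟ π₂ j
      ... | yes π₂i≡π₂j =
        i≢j (collapse i∈S j∈S π₂i≡π₂j (twins⇒universalʳ (clique i j i∈S j∈S i≢j) i≈j π₂i≡π₂j))
      ... | no  π₂i≢π₂j =
        tfY _ _ (proj₂ (∈⊠⁻ {X} {Y} (S⊆X⊠Y i∈S))) (proj₂ (∈⊠⁻ {X} {Y} (S⊆X⊠Y j∈S))) π₂i≢π₂j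
                (twins⇒twinsʳ (clique i j i∈S j∈S i≢j) i≈j)

    ⊠-twinsFreeˡ : ∀ {X K} → IsTwinsFreeClique G X → (∀ {a} → a ∈ X → ¬ Universal G a) → IsClique H K →
      IsTwinsFreeClique (G ⊕ H) (X ⊠ K)
    ⊠-twinsFreeˡ {X} {K} tfX nonUniversal cK =
      twinsFreeˡ tfX cK (λ i∈ → i∈) λ i∈ _ _ univ → contradiction univ (nonUniversal (proj₁ (∈⊠⁻ {X} {K} i∈)))

    ⊠-twinsFreeʳ : ∀ {K Y} → IsClique G K → IsTwinsFreeClique H Y → (∀ {b} → b ∈ Y → ¬ Universal H b) →
      IsTwinsFreeClique (G ⊕ H) (K ⊠ Y)
    ⊠-twinsFreeʳ {K} {Y} cK tfY nonUniversal =
      twinsFreeʳ cK tfY (λ i∈ → i∈) λ i∈ _ _ univ → contradiction univ (nonUniversal (proj₂ (∈⊠⁻ {K} {Y} i∈)))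

    punctured-twinsFreeˡ : ∀ {X K u k} → IsTwinsFreeClique G X → u ∈ X → (∀ {a} → a ∈ X → Universal G a → a ≡ u) →
      IsClique H K → k ∈ K → IsTwinsFreeClique (G ⊕ H) ((X - u) ⊠ K ∪ ⁅ u ⁆ ⊠ ⁅ k ⁆)
    punctured-twinsFreeˡ {X} {K} {u} {k} tfX u∈X only-u cK k∈K = twinsFreeˡ tfX cK S⊆X⊠K collapse
      where
      S : Subset (n * n')
      S = (X - u) ⊠ K ∪ ⁅ u ⁆ ⊠ ⁅ k ⁆
      S⊆X⊠K : S ⊆ X ⊠ K
      S⊆X⊠K i∈S = [ ⊠-mono {X - u} {X} {K} {K} (p─q⊆p X ⁅ u ⁆) (λ b∈K → b∈K)
                  , ⊠-mono {⁅ u ⁆} {X} {⁅ k ⁆} {K} (⁅x⁆⊆p u∈X) (⁅x⁆⊆p k∈K)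
                  ] (x∈p∪q⁻ ((X - u) ⊠ K) (⁅ u ⁆ ⊠ ⁅ k ⁆) i∈S)
      π₂≡k : ∀ {i} → i ∈ S → π₁ i ≡ u → π₂ i ≡ k
      π₂≡k {i} i∈S π₁i≡u with x∈p∪q⁻ ((X - u) ⊠ K) (⁅ u ⁆ ⊠ ⁅ k ⁆) i∈S
      ... | inj₁ i∈ = contradiction π₁i≡u (x∈p-y⇒x≢y (proj₁ (∈⊠⁻ {X - u} {K} i∈)))
      ... | inj₂ i∈ = x∈⁅y⁆⇒x≡y k (proj₂ (∈⊠⁻ {⁅ u ⁆} {⁅ k ⁆} i∈))
      collapse : ∀ {i j} → i ∈ S → j ∈ S → π₁ i ≡ π₁ j → Universal G (π₁ i) → i ≡ j
      collapse {i} i∈S j∈S π₁i≡π₁j univ =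
        π-injective π₁i≡π₁j (trans (π₂≡k i∈S π₁i≡u) (sym (π₂≡k j∈S (trans (sym π₁i≡π₁j) π₁i≡u))))
        where
        π₁i≡u : π₁ i ≡ u
        π₁i≡u = only-u (proj₁ (∈⊠⁻ {X} {K} (S⊆X⊠K i∈S))) univ

    punctured-twinsFreeʳ : ∀ {K Y k u} → IsClique G K → k ∈ K → IsTwinsFreeClique H Y → u ∈ Y →
      (∀ {b} → b ∈ Y → Universal H b → b ≡ u) → IsTwinsFreeClique (G ⊕ H) (K ⊠ (Y - u) ∪ ⁅ k ⁆ ⊠ ⁅ u ⁆)
    punctured-twinsFreeʳ {K} {Y} {k} {u} cK k∈K tfY u∈Y only-u = twinsFreeʳ cK tfY S⊆K⊠Y collapse
      where
      S : Subset (n * n')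
      S = K ⊠ (Y - u) ∪ ⁅ k ⁆ ⊠ ⁅ u ⁆
      S⊆K⊠Y : S ⊆ K ⊠ Y
      S⊆K⊠Y i∈S = [ ⊠-mono {K} {K} {Y - u} {Y} (λ a∈K → a∈K) (p─q⊆p Y ⁅ u ⁆)
                  , ⊠-mono {⁅ k ⁆} {K} {⁅ u ⁆} {Y} (⁅x⁆⊆p k∈K) (⁅x⁆⊆p u∈Y)
                  ] (x∈p∪q⁻ (K ⊠ (Y - u)) (⁅ k ⁆ ⊠ ⁅ u ⁆) i∈S)
      π₁≡k : ∀ {i} → i ∈ S → π₂ i ≡ u → π₁ i ≡ k
      π₁≡k {i} i∈S π₂i≡u with x∈p∪q⁻ (K ⊠ (Y - u)) (⁅ k ⁆ ⊠ ⁅ u ⁆) i∈S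
      ... | inj₁ i∈ = contradiction π₂i≡u (x∈p-y⇒x≢y (proj₂ (∈⊠⁻ {K} {Y - u} i∈)))
      ... | inj₂ i∈ = x∈⁅y⁆⇒x≡y k (proj₁ (∈⊠⁻ {⁅ k ⁆} {⁅ u ⁆} i∈))
      collapse : ∀ {i j} → i ∈ S → j ∈ S → π₂ i ≡ π₂ j → Universal H (π₂ i) → i ≡ j
      collapse {i} i∈S j∈S π₂i≡π₂j univ =
        π-injective (trans (π₁≡k i∈S π₂i≡u) (sym (π₁≡k j∈S (trans (sym π₂i≡π₂j) π₂i≡u)))) π₂i≡π₂j
        where
        π₂i≡u : π₂ i ≡ u
        π₂i≡u = only-u (proj₂ (∈⊠⁻ {K} {Y} (S⊆K⊠Y i∈S))) univ

    ϖ*ω≤ϖ⊕ : ∀ {ϖG ωH ϖGH} → HasMaxTFCliqueWithoutUniversal G ϖG → IsCliqueNumber H ωH →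
      IsTwinsFreeCliqueNumber (G ⊕ H) ϖGH → ϖG * ωH ≤ ϖGH
    ϖ*ω≤ϖ⊕ (X , tfX , refl , noFullDegree) ((K , cK , refl) , _) (_ , maximal) =
      subst (_≤ _) (∣A⊠B∣≡∣A∣*∣B∣ X K) (maximal (X ⊠ K) (⊠-twinsFreeˡ tfX nonUniversal cK))
      where
      nonUniversal : ∀ {a} → a ∈ X → ¬ Universal G a
      nonUniversal a∈X = noFullDegree _ a∈X ∘ universal⇒degree≡n∸1 G

    ω*ϖ≤ϖ⊕ : ∀ {ωG ϖH ϖGH} → IsCliqueNumber G ωG → HasMaxTFCliqueWithoutUniversal H ϖH →
      IsTwinsFreeCliqueNumber (G ⊕ H) ϖGH → ωG * ϖH ≤ ϖGH
    ω*ϖ≤ϖ⊕ ((K , cK , refl) , _) (Y , tfY , refl , noFullDegree) (_ , maximal) =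
      subst (_≤ _) (∣A⊠B∣≡∣A∣*∣B∣ K Y) (maximal (K ⊠ Y) (⊠-twinsFreeʳ cK tfY nonUniversal))
      where
      nonUniversal : ∀ {b} → b ∈ Y → ¬ Universal H b
      nonUniversal b∈Y = noFullDegree _ b∈Y ∘ universal⇒degree≡n∸1 H

    [ϖ∸1]*ω+1≤ϖ⊕ : ∀ {ϖG ωH ϖGH} → Fin n → Fin n' → IsTwinsFreeCliqueNumber G ϖG → IsCliqueNumber H ωH →
      IsTwinsFreeCliqueNumber (G ⊕ H) ϖGH → (ϖG ∸ 1) * ωH + 1 ≤ ϖGH
    [ϖ∸1]*ω+1≤ϖ⊕ x y ϖG@((X , tfX , refl) , _) ωH@((K , cK , refl) , _) (_ , maximal)
      with universal-candidate G tfX (1≤∣p∣⇒nonempty X (1≤ϖ G x ϖG)) | 1≤∣p∣⇒nonempty K (1≤ω H y ωH)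
    ... | u , u∈X , only-u | k , k∈K =
      subst (_≤ _) (∣[A-a]⊠B∪⁅a⁆⊠⁅b⁆∣ K k u∈X) (maximal _ (punctured-twinsFreeˡ tfX u∈X only-u cK k∈K))

    ω*[ϖ∸1]+1≤ϖ⊕ : ∀ {ωG ϖH ϖGH} → Fin n → Fin n' → IsCliqueNumber G ωG → IsTwinsFreeCliqueNumber H ϖH →
      IsTwinsFreeCliqueNumber (G ⊕ H) ϖGH → ωG * (ϖH ∸ 1) + 1 ≤ ϖGH
    ω*[ϖ∸1]+1≤ϖ⊕ x y ωG@((K , cK , refl) , _) ϖH@((Y , tfY , refl) , _) (_ , maximal)
      with 1≤∣p∣⇒nonempty K (1≤ω G x ωG) | universal-candidate H tfY (1≤∣p∣⇒nonempty Y (1≤ϖ H y ϖH))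
    ... | k , k∈K | u , u∈Y , only-u =
      subst (_≤ _) (∣A⊠[B-b]∪⁅a⁆⊠⁅b⁆∣ K k u∈Y) (maximal _ (punctured-twinsFreeʳ cK k∈K tfY u∈Y only-u))

corollary3 : ∀ {n n'} (G : Graph n) (H : Graph n') → 2 ≤ n → 2 ≤ n' →
    ∀ ωG ωH ϖG ϖH ϖGH →
    IsCliqueNumber G ωG → IsCliqueNumber H ωH →
    IsTwinsFreeCliqueNumber G ϖG → IsTwinsFreeCliqueNumber H ϖH →
    IsTwinsFreeCliqueNumber (G ⊕ H) ϖGH →
    (((ϖG ∸ 1) * ωH) ⊔ (ωG * (ϖH ∸ 1))) + 1 ≤ ϖGH
    × (HasMaxTFCliqueWithoutUniversal G ϖG → HasMaxTFCliqueWithoutUniversal H ϖH →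
        (ϖG * ωH) ⊔ (ωG * ϖH) ≤ ϖGH)
    × (HasMaxTFCliqueWithoutUniversal G ϖG →
        (ϖG * ωH) ⊔ ((ωG * (ϖH ∸ 1)) + 1) ≤ ϖGH)
corollary3 G H (s≤s _) (s≤s _) ωG ωH ϖG ϖH ϖGH ωG-max ωH-max ϖG-max ϖH-max ϖGH-max =
    subst (_≤ ϖGH) (sym (+-distribʳ-⊔ 1 ((ϖG ∸ 1) * ωH) (ωG * (ϖH ∸ 1)))) (⊔-lub boundˡ boundʳ)
  , (λ hasG hasH → ⊔-lub (ϖ*ω≤ϖ⊕ G H hasG ωH-max ϖGH-max) (ω*ϖ≤ϖ⊕ G H ωG-max hasH ϖGH-max))
  , (λ hasG → ⊔-lub (ϖ*ω≤ϖ⊕ G H hasG ωH-max ϖGH-max) boundʳ)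
  where
  boundˡ : (ϖG ∸ 1) * ωH + 1 ≤ ϖGH
  boundˡ = [ϖ∸1]*ω+1≤ϖ⊕ G H zero zero ϖG-max ωH-max ϖGH-max
  boundʳ : ωG * (ϖH ∸ 1) + 1 ≤ ϖGH
  boundʳ = ω*[ϖ∸1]+1≤ϖ⊕ G H zero zero ωG-max ϖH-max ϖGH-max
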